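{- Let $n\in\mathbb{N}$, $k\in[n+1]$ and $d$ a positive integer. For $\mathbf{x}=(x_1,\ldots,x_n)\in\mathrm{DPF}^\uparrow_{n,n,d}$ with $x_n\le k$, let $i\in[n]$ be the first index with $\delta(\mathbf{x})_i>0$, and set \[\varphi(\mathbf{x})=(\mathbf{x}',i),\qquad \mathbf{x}'=(x_1,\ldots,x_{i-1},x_i-1,x_{i+1}-1,\ldots,x_n-1).\] Then $\varphi$ is a bijection from $\{\mathbf{x}\in\mathrm{DPF}^\uparrow_{n,n,d}: x_n\le k\}$ to $\{(\mathbf{x}',j)\in N_{n,d-1}: x'_n\le k-1\}$. Moreover, $D(\mathbf{x})=\{j\in D(\mathbf{x}')\mid j\le i\}$.
   Context: For $\mathbf{x}\in[n+1]^n$: cars $1,\ldots,n$ arrive in order at an infinitely long street with spots $1,2,3,\ldots$, car $i$ parking in the first empty spot numbered $\ge x_i$; the defect is the number of cars parking in a spot numbered greater than $n$. $\mathrm{DPF}^\uparrow_{n,n,d}$ is the set of nondecreasing $\mathbf{x}\in[n+1]^n$ with defect $d$. For such $\mathbf{x}$, $\delta(\mathbf{x})_i=x_i-i$. The decrement set $D(\mathbf{x})\subseteq[n]$ is the set of indices $i$ such that $\delta(\mathbf{x})_i\ge0$ and there is no $j<i$ with $\delta(\mathbf{x})_j>0$. The decrement pair set is $N_{n,d}=\{(\mathbf{x},i):\mathbf{x}\in\mathrm{DPF}^\uparrow_{n,n,d},\ i\in D(\mathbf{x})\}$. -}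

module Defs where

open import Data.Nat using (ℕ; zero; suc; _+_; _∸_; _≤_; _<_; _<ᵇ_; _≡ᵇ_)
open import Data.Bool using (Bool; true; false; if_then_else_; _∨_)
open import Data.List using (List; []; _∷_; length; foldl; filter)
open import Data.Bool.ListAction using (any)
open import Data.Vec using (Vec; []; _∷_; lookup; tabulate; toList; last)
open import Data.Fin using (Fin; toℕ) renaming (zero to fzero; suc to fsuc)
import Data.Fin as F
open import Data.Maybe using (Maybe; just; nothing) renaming (map to mapMaybe)
open import Data.Product using (_×_; _,_)
open import Data.Unit using (⊤)
open import Relation.Nullary using (¬_)
open import Relation.Binary.PropositionalEquality using (_≡_)

-- Conventions: a preference vector x ∈ [n+1]^n is a  Vec ℕ n  whose entries
-- are 1-based spot numbers.  Index (Fin) i corresponds to the paper's index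
-- toℕ i + 1.

occupied : List ℕ → ℕ → Bool
occupied occ a = any (λ b → a ≡ᵇ b) occ

-- first empty spot ≥ a, searching with fuel (fuel = number of occupied
-- spots suffices, since at most that many spots can be skipped)
firstFree : ℕ → List ℕ → ℕ → ℕ
firstFree zero     occ a = a
firstFree (suc f) occ a = if occupied occ a then firstFree f occ (suc a) else a

parkStep : List ℕ → ℕ → List ℕ
parkStep occ a = firstFree (length occ) occ a ∷ occ

parkAll : List ℕ → List ℕ
parkAll prefs = foldl parkStep [] prefs

defect : (n : ℕ) → Vec ℕ n → ℕ
defect n x = length (filter (λ s → n Data.Nat.<? s) (parkAll (toList x)))

Nondecreasing : {n : ℕ} → Vec ℕ n → Set
Nondecreasing {n} x = ∀ (i j : Fin n) → i F.≤ j → lookup x i ≤ lookup x j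

InRange : {n : ℕ} → Vec ℕ n → Set
InRange {n} x = ∀ (i : Fin n) → 1 ≤ lookup x i × lookup x i ≤ suc n

DPFup : (n d : ℕ) → Vec ℕ n → Set
DPFup n d x = InRange x × Nondecreasing x × defect n x ≡ d

-- x_n ≤ k  (vacuous when n = 0)
LastLe : {n : ℕ} → Vec ℕ n → ℕ → Set
LastLe {zero}  x k = ⊤
LastLe {suc m} x k = last x ≤ k

-- δ(x)_i > 0   i.e.  x_i > i   (paper index i = toℕ i + 1)
DeltaPos : {n : ℕ} → Vec ℕ n → Fin n → Set
DeltaPos x i = suc (toℕ i) < lookup x i

DeltaNonneg : {n : ℕ} → Vec ℕ n → Fin n → Set
DeltaNonneg x i = suc (toℕ i) ≤ lookup x i

InD : {n : ℕ} → Vec ℕ n → Fin n → Set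
InD {n} x i = DeltaNonneg x i × (∀ (j : Fin n) → j F.< i → ¬ DeltaPos x j)

InN : (n d : ℕ) → Vec ℕ n → Fin n → Set
InN n d x i = DPFup n d x × InD x i

-- first index i with δ(x)_i > 0 (offset o = number of preceding entries)
firstPosFrom : {m : ℕ} → ℕ → Vec ℕ m → Maybe (Fin m)
firstPosFrom o []      = nothing
firstPosFrom o (a ∷ v) =
  if suc o <ᵇ a then just fzero else mapMaybe fsuc (firstPosFrom (suc o) v)

firstPos : {n : ℕ} → Vec ℕ n → Maybe (Fin n)
firstPos x = firstPosFrom 0 x

decr : {n : ℕ} → Vec ℕ n → Fin n → Vec ℕ n
decr x i = tabulate (λ j → if toℕ j <ᵇ toℕ i then lookup x j else lookup x j ∸ 1)

φ : {n : ℕ} → Vec ℕ n → Maybe (Vec ℕ n × Fin n)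
φ x = mapMaybe (λ i → decr x i , i) (firstPos x)

{-# OPTIONS --safe #-}
-- For nondecreasing preferences parking is explicit: a car preferring b that arrives after a
-- car parked at s takes spot max(b, s + 1), so the defect counts the spots of this trajectory
-- beyond n. Let i be the first index with δ > 0. Lowering x_i, …, x_n by one lowers every spot
-- from car i on by exactly one, since max(b - 1, s) = max(b, s + 1) - 1. Those spots start at
-- x_i ≥ i + 1 and rise by at least one per car, so they reach n + 1; and as no preference
-- exceeds n + 1 they cannot jump past it. Hence exactly one of them equals n + 1, and the
-- shift loses exactly one overflowing car. Raising the entries from index i by one inverts φ,
-- and x and x' agree before i, which gives the description of D(x).
module Submission where

open import Defs
open import Data.Nat using (ℕ; zero; suc; _+_; _∸_; _⊔_; _≤_; _<_; _<ᵇ_; z≤n; s≤s; z<s; _<?_)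
open import Data.Nat.Properties
open import Data.Bool using (true; false; if_then_else_; _∨_)
open import Data.Bool.Properties using (∨-zeroʳ)
open import Data.List as List using (List; []; _∷_; length; foldl; filter; reverse; _ʳ++_)
open import Data.List.Properties using (filter-accept; filter-reject; filter-all)
open import Data.List.Relation.Unary.All as All using (All; []; _∷_)
open import Data.List.Relation.Unary.Linked using (Linked; [-]; _∷_)
open import Data.List.Relation.Binary.Permutation.Propositional.Properties using (↭-length; filter-↭; ↭-reverse)
open import Data.Vec as Vec using (Vec; []; _∷_; lookup; tabulate; toList; last)
open import Data.Vec.Properties using (lookup∘tabulate; toList-map; length-toList)
open import Data.Vec.Relation.Binary.Pointwise.Extensional using (ext; Pointwise-≡⇒≡)
open import Data.Vec.Relation.Unary.All.Properties using (toList⁺; lookup⁻)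
open import Data.Fin using (Fin; toℕ) renaming (zero to fzero; suc to fsuc)
import Data.Fin as F
import Data.Fin.Properties as FinP
open import Data.Maybe using (just; nothing) renaming (map to mapMaybe)
open import Data.Maybe.Properties using (just-injective)
open import Data.Sum using (inj₁; inj₂)
open import Data.Product using (_×_; _,_; ∃; proj₁; proj₂)
open import Data.Product.Properties using (,-injective)
open import Function.Base using (_∘_)
open import Function.Bundles using (_⇔_; mk⇔)
open import Relation.Binary.Definitions using (tri<; tri≈; tri>)
open import Relation.Binary.PropositionalEquality
open import Relation.Nullary using (¬_; yes; no; contradiction)
open import Relation.Nullary.Decidable using (dec-true; dec-false)
open import Relation.Nullary.Reflects using (ofʸ; ofⁿ)

-- The spots taken by cars with nondecreasing preferences l, the previous car having parked at s.
spots : ℕ → List ℕ → List ℕ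
spots s []      = []
spots s (b ∷ l) = b ⊔ suc s ∷ spots (b ⊔ suc s) l

-- Spots lo … hi are taken and none beyond hi; the fuel condition lets firstFree skip that block.
record Parked (occ : List ℕ) (lo hi : ℕ) : Set where
  field
    free-above : ∀ s → hi < s → occupied occ s ≡ false
    full-from  : ∀ s → lo ≤ s → s ≤ hi → occupied occ s ≡ true
    fuel       : hi < length occ + lo

firstFree-free : ∀ f occ a → occupied occ a ≡ false → firstFree f occ a ≡ a
firstFree-free zero    occ a _    = refl
firstFree-free (suc f) occ a free rewrite free = refl

firstFree-skip : ∀ f occ a p → (∀ s → a ≤ s → s ≤ p → occupied occ s ≡ true) →
  occupied occ (suc p) ≡ false → a ≤ suc p → suc p ≤ f + a → firstFree f occ a ≡ suc p
firstFree-skip zero    occ a p _    _    a≤ ≤f+a = ≤-antisym a≤ ≤f+a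
firstFree-skip (suc f) occ a p full free a≤ ≤f+a with m≤n⇒m<n∨m≡n a≤
... | inj₂ refl = firstFree-free (suc f) occ a free
... | inj₁ (s≤s a≤p) rewrite full a ≤-refl a≤p =
  firstFree-skip f occ (suc a) p (λ s a<s → full s (<⇒≤ a<s)) free (s≤s a≤p)
    (subst (suc p ≤_) (sym (+-suc f a)) ≤f+a)

module _ {occ : List ℕ} {lo hi a : ℕ} (parked : Parked occ lo hi) (lo≤a : lo ≤ a) where
  open Parked parked

  firstFree-Parked : firstFree (length occ) occ a ≡ a ⊔ suc hi
  firstFree-Parked with a ≤? suc hi
  ... | yes a≤ = trans
    (firstFree-skip (length occ) occ a hi (λ s a≤s → full-from s (≤-trans lo≤a a≤s))
      (free-above (suc hi) ≤-refl) a≤ (≤-trans fuel (+-monoʳ-≤ (length occ) lo≤a)))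
    (sym (m≤n⇒m⊔n≡n a≤))
  ... | no a≰ = trans (firstFree-free (length occ) occ a (free-above a hi<a)) (sym (m≥n⇒m⊔n≡m hi<a))
    where hi<a = <⇒≤ (≰⇒> a≰)

  -- does (s ≟ t) reduces to the test s ≡ᵇ t made by occupied.
  Parked-∷ : Parked (a ⊔ suc hi ∷ occ) a (a ⊔ suc hi)
  Parked-∷ = record
    { free-above = λ s p<s → cong₂ _∨_ (dec-false (s ≟ a ⊔ suc hi) (<⇒≢ p<s ∘ sym))
                                       (free-above s (<-trans (m≤n⊔m a (suc hi)) p<s))
    ; full-from  = full
    ; fuel       = s≤s (⊔-lub (m≤n+m a (length occ)) (≤-trans fuel (+-monoʳ-≤ (length occ) lo≤a)))
    }
    where
    full : ∀ s → a ≤ s → s ≤ a ⊔ suc hi → occupied (a ⊔ suc hi ∷ occ) s ≡ true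
    full s a≤s s≤p with m≤n⇒m<n∨m≡n s≤p
    ... | inj₂ refl = cong (_∨ occupied occ s) (dec-true (s ≟ s) refl)
    ... | inj₁ s<p  = trans (cong (_ ∨_) (full-from s (≤-trans lo≤a a≤s) s≤hi)) (∨-zeroʳ _)
      where s≤hi = ≮⇒≥ λ hi<s → <⇒≱ s<p (⊔-lub a≤s hi<s)

foldl-parkStep : ∀ {occ lo hi} l → Parked occ lo hi → Linked _≤_ (lo ∷ l) →
  foldl parkStep occ l ≡ spots hi l ʳ++ occ
foldl-parkStep []      _      _               = refl
foldl-parkStep (a ∷ l) parked (lo≤a ∷ sorted) rewrite firstFree-Parked parked lo≤a =
  foldl-parkStep l (Parked-∷ parked lo≤a) sorted

parkAll-sorted : ∀ l → Linked _≤_ (1 ∷ l) → parkAll l ≡ reverse (spots 0 l)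
parkAll-sorted l = foldl-parkStep l record
  { free-above = λ _ _ → refl
  ; full-from  = λ s 1≤s s≤0 → contradiction s≤0 (<⇒≱ 1≤s)
  ; fuel       = s≤s z≤n
  }

overflow : ℕ → List ℕ → ℕ
overflow N ps = length (filter (N <?_) ps)

overflow-reverse : ∀ N ps → overflow N (reverse ps) ≡ overflow N ps
overflow-reverse N ps = ↭-length (filter-↭ (N <?_) (↭-reverse ps))

overflow-all : ∀ N {ps} → All (N <_) ps → overflow N ps ≡ length ps
overflow-all N above = cong length (filter-all (N <?_) above)

-- does (N <? h) reduces to N <ᵇ h, so the with-abstractions below decide filter's branch.
overflow-∷-suc : ∀ N h {xs ys} → overflow N xs ≡ suc (overflow N ys) →
  overflow N (h ∷ xs) ≡ suc (overflow N (h ∷ ys))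
overflow-∷-suc N h eq with N <ᵇ h
... | true  = cong suc eq
... | false = eq

overflow-map-pred : ∀ N ps → overflow N (List.map (_∸ 1) ps) ≡ overflow (suc N) ps
overflow-map-pred N []           = refl
overflow-map-pred N (zero ∷ ps)  = overflow-map-pred N ps
overflow-map-pred N (suc p ∷ ps) with N <ᵇ p
... | true  = cong suc (overflow-map-pred N ps)
... | false = overflow-map-pred N ps

spots-increasing : ∀ s l → All (s <_) (spots s l)
spots-increasing s []      = []
spots-increasing s (b ∷ l) = s<p ∷ All.map (<-trans s<p) (spots-increasing (b ⊔ suc s) l)
  where s<p = m≤n⊔m b (suc s)

spots-∷ : ∀ {q a} l → q < a → spots q (a ∷ l) ≡ a ∷ spots a l
spots-∷ l q<a = cong (λ p → p ∷ spots p l) (m≥n⇒m⊔n≡m q<a)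

spots-map-pred : ∀ t l → spots t (List.map (_∸ 1) l) ≡ List.map (_∸ 1) (spots (suc t) l)
spots-map-pred t []          = refl
spots-map-pred t (zero ∷ l)  = cong (suc t ∷_) (spots-map-pred (suc t) l)
spots-map-pred t (suc b ∷ l) = cong (b ⊔ suc t ∷_) (spots-map-pred (b ⊔ suc t) l)

overflow-crossing : ∀ N a w → a ≤ suc N → All (_≤ suc N) w → suc N ≤ a + length w →
  overflow N (a ∷ spots a w) ≡ suc (overflow (suc N) (a ∷ spots a w))
overflow-crossing N a w a≤ bounded reach with m≤n⇒m<n∨m≡n a≤
... | inj₂ refl = begin
  overflow N (suc N ∷ ps)              ≡⟨ cong length (filter-accept (N <?_) ≤-refl) ⟩
  suc (overflow N ps)                  ≡⟨ cong suc (overflow-all N (All.map (<-trans (n<1+n N)) above)) ⟩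
  suc (length ps)                      ≡⟨ cong suc (overflow-all (suc N) above) ⟨
  suc (overflow (suc N) ps)            ≡⟨ cong (suc ∘ length) (filter-reject (suc N <?_) (n≮n (suc N))) ⟨
  suc (overflow (suc N) (suc N ∷ ps))  ∎
  where
  open ≡-Reasoning
  ps    = spots (suc N) w
  above = spots-increasing (suc N) w
overflow-crossing N a []      a≤ bounded         reach | inj₁ (s≤s a≤N) =
  contradiction a≤N (<⇒≱ (subst (suc N ≤_) (+-identityʳ a) reach))
overflow-crossing N a (b ∷ w) a≤ (b≤ ∷ bounded) reach | inj₁ (s≤s a≤N) = begin
  overflow N (a ∷ p ∷ ps)              ≡⟨ cong length (filter-reject (N <?_) (≤⇒≯ a≤N)) ⟩
  overflow N (p ∷ ps)                  ≡⟨ overflow-crossing N p w (⊔-lub b≤ (s≤s a≤N)) bounded reach′ ⟩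
  suc (overflow (suc N) (p ∷ ps))      ≡⟨ cong (suc ∘ length) (filter-reject (suc N <?_) (≤⇒≯ a≤)) ⟨
  suc (overflow (suc N) (a ∷ p ∷ ps))  ∎
  where
  open ≡-Reasoning
  p  = b ⊔ suc a
  ps = spots p w
  reach′ : suc N ≤ p + length w
  reach′ = ≤-trans reach (≤-trans (≤-reflexive (+-suc a (length w))) (+-monoˡ-≤ (length w) (m≤n⊔m b (suc a))))

-- decr x i is definitionally mapFrom (_∸ 1) x i.
mapFrom : ∀ {A : Set} {n} → (A → A) → Vec A n → Fin n → Vec A n
mapFrom f x i = tabulate (λ j → if toℕ j <ᵇ toℕ i then lookup x j else f (lookup x j))

incr : ∀ {n} → Vec ℕ n → Fin n → Vec ℕ n
incr = mapFrom suc

module _ {A : Set} {n} (f : A → A) (x : Vec A n) (i : Fin n) where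

  lookup-mapFrom : ∀ j → lookup (mapFrom f x i) j ≡ (if toℕ j <ᵇ toℕ i then lookup x j else f (lookup x j))
  lookup-mapFrom = lookup∘tabulate _

  lookup-mapFrom-< : ∀ {j} → j F.< i → lookup (mapFrom f x i) j ≡ lookup x j
  lookup-mapFrom-< {j} j<i rewrite lookup-mapFrom j with toℕ j <ᵇ toℕ i | <ᵇ-reflects-< (toℕ j) (toℕ i)
  ... | true  | _       = refl
  ... | false | ofⁿ j≮i = contradiction j<i j≮i

  lookup-mapFrom-≥ : ∀ {j} → i F.≤ j → lookup (mapFrom f x i) j ≡ f (lookup x j)
  lookup-mapFrom-≥ {j} i≤j rewrite lookup-mapFrom j with toℕ j <ᵇ toℕ i | <ᵇ-reflects-< (toℕ j) (toℕ i)
  ... | true  | ofʸ j<i = contradiction i≤j (<⇒≱ j<i)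
  ... | false | _       = refl

  mapFrom-pointwise : (P : A → Set) → (∀ j → j F.< i → P (lookup x j)) → (∀ j → i F.≤ j → P (f (lookup x j))) →
    ∀ j → P (lookup (mapFrom f x i) j)
  mapFrom-pointwise P before after j with j F.<? i
  ... | yes j<i = subst P (sym (lookup-mapFrom-< j<i)) (before j j<i)
  ... | no  j≮i = subst P (sym (lookup-mapFrom-≥ (≮⇒≥ j≮i))) (after j (≮⇒≥ j≮i))

mapFrom-inverse : ∀ {A : Set} {n} (f g : A → A) (x : Vec A n) i →
  (∀ j → i F.≤ j → g (f (lookup x j)) ≡ lookup x j) → mapFrom g (mapFrom f x i) i ≡ x
mapFrom-inverse f g x i inverse = Pointwise-≡⇒≡ (ext pointwise)
  where
  open ≡-Reasoning
  pointwise : ∀ j → lookup (mapFrom g (mapFrom f x i) i) j ≡ lookup x j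
  pointwise j with j F.<? i
  ... | yes j<i = trans (lookup-mapFrom-< g (mapFrom f x i) i j<i) (lookup-mapFrom-< f x i j<i)
  ... | no  j≮i = begin
    lookup (mapFrom g (mapFrom f x i) i) j ≡⟨ lookup-mapFrom-≥ g (mapFrom f x i) i (≮⇒≥ j≮i) ⟩
    g (lookup (mapFrom f x i) j)           ≡⟨ cong g (lookup-mapFrom-≥ f x i (≮⇒≥ j≮i)) ⟩
    g (f (lookup x j))                     ≡⟨ inverse j (≮⇒≥ j≮i) ⟩
    lookup x j                             ∎

mapFrom-zero : ∀ {A : Set} {m} (f : A → A) (x : Vec A (suc m)) → mapFrom f x fzero ≡ Vec.map f x
mapFrom-zero f (a ∷ [])    = refl
mapFrom-zero f (a ∷ b ∷ w) = cong (f a ∷_) (mapFrom-zero f (b ∷ w))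

last-mapFrom : ∀ {A : Set} {m} (f : A → A) (x : Vec A (suc m)) i → last (mapFrom f x i) ≡ f (last x)
last-mapFrom f (a ∷ [])    fzero    = refl
last-mapFrom f (a ∷ b ∷ w) fzero    = last-mapFrom f (b ∷ w) fzero
last-mapFrom f (a ∷ b ∷ w) (fsuc i) = last-mapFrom f (b ∷ w) i

mapFrom-nondecreasing : ∀ {n} (f : ℕ → ℕ) (x : Vec ℕ n) i → (∀ {a b} → a ≤ b → f a ≤ f b) →
  (∀ j → j F.< i → lookup x j ≤ f (lookup x i)) → Nondecreasing x → Nondecreasing (mapFrom f x i)
mapFrom-nondecreasing f x i mono below nd l l′ l≤l′ with l F.<? i | l′ F.<? i
... | yes l<i | yes l′<i = subst₂ _≤_ (sym (lookup-mapFrom-< f x i l<i)) (sym (lookup-mapFrom-< f x i l′<i))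
                             (nd l l′ l≤l′)
... | yes l<i | no  l′≮i = subst₂ _≤_ (sym (lookup-mapFrom-< f x i l<i)) (sym (lookup-mapFrom-≥ f x i (≮⇒≥ l′≮i)))
                             (≤-trans (below l l<i) (mono (nd i l′ (≮⇒≥ l′≮i))))
... | no  l≮i | yes l′<i = contradiction (≤-<-trans l≤l′ l′<i) l≮i
... | no  l≮i | no  l′≮i = subst₂ _≤_ (sym (lookup-mapFrom-≥ f x i (≮⇒≥ l≮i))) (sym (lookup-mapFrom-≥ f x i (≮⇒≥ l′≮i)))
                             (mono (nd l l′ l≤l′))

nondecreasing-tail : ∀ {n a} {w : Vec ℕ n} → Nondecreasing (a ∷ w) → Nondecreasing w
nondecreasing-tail nd i j i≤j = nd (fsuc i) (fsuc j) (s≤s i≤j)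

lookup≤last : ∀ {m} (x : Vec ℕ (suc m)) → Nondecreasing x → ∀ j → lookup x j ≤ last x
lookup≤last (a ∷ [])    nd fzero    = ≤-refl
lookup≤last (a ∷ b ∷ w) nd fzero    = ≤-trans (nd fzero (fsuc fzero) z≤n) (lookup≤last (b ∷ w) (nondecreasing-tail nd) fzero)
lookup≤last (a ∷ b ∷ w) nd (fsuc j) = lookup≤last (b ∷ w) (nondecreasing-tail nd) j

LastLe⇒lookup≤ : ∀ {n} (x : Vec ℕ n) k → Nondecreasing x → LastLe x k → ∀ j → lookup x j ≤ k
LastLe⇒lookup≤ {suc m} x k nd le j = ≤-trans (lookup≤last x nd j) le

nondecreasing-linked : ∀ {n lo} (x : Vec ℕ n) → (∀ j → lo ≤ lookup x j) → Nondecreasing x → Linked _≤_ (lo ∷ toList x)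
nondecreasing-linked []      _   _  = [-]
nondecreasing-linked (a ∷ w) lo≤ nd =
  lo≤ fzero ∷ nondecreasing-linked w (λ j → nd fzero (fsuc j) z≤n) (nondecreasing-tail nd)

InRange⇒All≤ : ∀ {n} (x : Vec ℕ n) → InRange x → All (_≤ suc n) (toList x)
InRange⇒All≤ x range = toList⁺ (lookup⁻ (proj₂ ∘ range))

defect-sorted : ∀ {n} (x : Vec ℕ n) → InRange x → Nondecreasing x → defect n x ≡ overflow n (spots 0 (toList x))
defect-sorted {n} x range nd = begin
  overflow n (parkAll (toList x))           ≡⟨ cong (overflow n) (parkAll-sorted (toList x) sorted) ⟩
  overflow n (reverse (spots 0 (toList x))) ≡⟨ overflow-reverse n (spots 0 (toList x)) ⟩
  overflow n (spots 0 (toList x))           ∎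
  where
  open ≡-Reasoning
  sorted = nondecreasing-linked x (proj₁ ∘ range) nd

-- v is read as the entries o + 1, o + 2, … of a longer vector; at o = 0, i is the first
-- index with δ > 0.
FirstDeltaPosFrom : ∀ {m} → ℕ → Vec ℕ m → Fin m → Set
FirstDeltaPosFrom o v i = suc (o + toℕ i) < lookup v i × (∀ j → j F.< i → ¬ suc (o + toℕ j) < lookup v j)

firstPosFrom⇒FirstDeltaPosFrom : ∀ {m} o (v : Vec ℕ m) {i} → firstPosFrom o v ≡ just i → FirstDeltaPosFrom o v i
firstPosFrom⇒FirstDeltaPosFrom o (a ∷ w) eq
  with suc o <ᵇ a | <ᵇ-reflects-< (suc o) a | firstPosFrom (suc o) w in eq′
... | true  | ofʸ o<a | _ with refl ← eq = subst (_< a) (cong suc (sym (+-identityʳ o))) o<a , λ _ ()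
firstPosFrom⇒FirstDeltaPosFrom o (a ∷ w) () | false | _ | nothing
... | false | ofⁿ o≮a | just i′ with refl ← eq | pos , below ← firstPosFrom⇒FirstDeltaPosFrom (suc o) w eq′ =
  subst (_< lookup w i′) (cong suc (sym (+-suc o (toℕ i′)))) pos , below′
  where
  below′ : ∀ j → j F.< fsuc i′ → ¬ suc (o + toℕ j) < lookup (a ∷ w) j
  below′ fzero    _         = subst (λ t → ¬ t < a) (cong suc (sym (+-identityʳ o))) o≮a
  below′ (fsuc j) (s≤s j<i) = subst (λ t → ¬ t < lookup w j) (cong suc (sym (+-suc o (toℕ j)))) (below j j<i)

FirstDeltaPosFrom⇒firstPosFrom : ∀ {m} o (v : Vec ℕ m) i → FirstDeltaPosFrom o v i → firstPosFrom o v ≡ just i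
FirstDeltaPosFrom⇒firstPosFrom o (a ∷ w) fzero (pos , _) with suc o <ᵇ a | <ᵇ-reflects-< (suc o) a
... | true  | _       = refl
... | false | ofⁿ o≮a = contradiction (subst (_< a) (cong suc (+-identityʳ o)) pos) o≮a
FirstDeltaPosFrom⇒firstPosFrom o (a ∷ w) (fsuc i) (pos , below) with suc o <ᵇ a | <ᵇ-reflects-< (suc o) a
... | true  | ofʸ o<a = contradiction (subst (_< a) (cong suc (sym (+-identityʳ o))) o<a) (below fzero z<s)
... | false | _       = cong (mapMaybe fsuc) (FirstDeltaPosFrom⇒firstPosFrom (suc o) w i (pos′ , below′))
  where
  pos′ : suc (suc o + toℕ i) < lookup w i
  pos′ = subst (_< lookup w i) (cong suc (+-suc o (toℕ i))) pos
  below′ : ∀ j → j F.< i → ¬ suc (suc o + toℕ j) < lookup w j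
  below′ j j<i = subst (λ t → ¬ t < lookup w j) (cong suc (+-suc o (toℕ j))) (below (fsuc j) (s≤s j<i))

overflow-decr-head : ∀ N q {a} w → suc q < a → a ≤ suc N → All (_≤ suc N) w → suc N ≤ a + length w →
  overflow N (spots q (a ∷ w)) ≡ suc (overflow N (spots q (a ∸ 1 ∷ List.map (_∸ 1) w)))
overflow-decr-head N q {suc s} w (s≤s q<s) a≤ bounded reach = begin
  overflow N (spots q (suc s ∷ w))                          ≡⟨ cong (overflow N) (spots-∷ w (m<n⇒m<1+n q<s)) ⟩
  overflow N (suc s ∷ spots (suc s) w)                      ≡⟨ overflow-crossing N (suc s) w a≤ bounded reach ⟩
  suc (overflow (suc N) (suc s ∷ spots (suc s) w))          ≡⟨ cong suc (overflow-map-pred N (suc s ∷ spots (suc s) w)) ⟨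
  suc (overflow N (s ∷ List.map (_∸ 1) (spots (suc s) w)))  ≡⟨ cong (λ ps → suc (overflow N (s ∷ ps))) (spots-map-pred s w) ⟨
  suc (overflow N (s ∷ spots s (List.map (_∸ 1) w)))        ≡⟨ cong (suc ∘ overflow N) (spots-∷ (List.map (_∸ 1) w) q<s) ⟨
  suc (overflow N (spots q (s ∷ List.map (_∸ 1) w)))        ∎
  where open ≡-Reasoning

overflow-decr : ∀ {N m} o q (v : Vec ℕ m) {i} → firstPosFrom o v ≡ just i → q ≤ o → o + m ≡ N →
  All (_≤ suc N) (toList v) → overflow N (spots q (toList v)) ≡ suc (overflow N (spots q (toList (decr v i))))
overflow-decr o q (a ∷ w) eq q≤o o+m bounded
  with suc o <ᵇ a | <ᵇ-reflects-< (suc o) a | firstPosFrom (suc o) w in eq′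
overflow-decr {N} {suc m} o q (a ∷ w) refl q≤o o+m (a≤ ∷ bounded) | true | ofʸ o<a | _ =
  trans (overflow-decr-head N q (toList w) (≤-trans (s≤s (s≤s q≤o)) o<a) a≤ bounded reach)
        (cong (suc ∘ overflow N ∘ spots q) (sym toList-decr))
  where
  reach : suc N ≤ a + length (toList w)
  reach = subst₂ _≤_ (cong suc (trans (sym (+-suc o m)) o+m)) (cong (a +_) (sym (length-toList w))) (+-monoˡ-≤ m o<a)
  toList-decr : toList (decr (a ∷ w) fzero) ≡ a ∸ 1 ∷ List.map (_∸ 1) (toList w)
  toList-decr = trans (cong toList (mapFrom-zero (_∸ 1) (a ∷ w))) (toList-map (_∸ 1) (a ∷ w))
overflow-decr o q (a ∷ w) () q≤o o+m bounded | false | _ | nothing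
overflow-decr {N} {suc m} o q (a ∷ w) refl q≤o o+m (_ ∷ bounded) | false | ofⁿ o≮a | just i′ =
  overflow-∷-suc N (a ⊔ suc q)
    (overflow-decr (suc o) (a ⊔ suc q) w eq′ (⊔-lub (≮⇒≥ o≮a) (s≤s q≤o)) (trans (sym (+-suc o m)) o+m) bounded)

firstPosFrom-nothing⇒overflow≡0 : ∀ {N m} o q (v : Vec ℕ m) → firstPosFrom o v ≡ nothing → q ≤ o → o + m ≡ N →
  overflow N (spots q (toList v)) ≡ 0
firstPosFrom-nothing⇒overflow≡0 o q []      _  _   _ = refl
firstPosFrom-nothing⇒overflow≡0 o q (a ∷ w) eq q≤o o+m
  with suc o <ᵇ a | <ᵇ-reflects-< (suc o) a | firstPosFrom (suc o) w in eq′
firstPosFrom-nothing⇒overflow≡0 o q (a ∷ w) () q≤o o+m | true  | _ | _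
firstPosFrom-nothing⇒overflow≡0 o q (a ∷ w) () q≤o o+m | false | _ | just _
firstPosFrom-nothing⇒overflow≡0 {N} {suc m} o q (a ∷ w) _ q≤o o+m | false | ofⁿ o≮a | nothing =
  trans (cong length (filter-reject (N <?_) (≤⇒≯ (≤-trans h≤1+o 1+o≤N))))
        (firstPosFrom-nothing⇒overflow≡0 (suc o) (a ⊔ suc q) w eq′ h≤1+o (trans (sym (+-suc o m)) o+m))
  where
  h≤1+o : a ⊔ suc q ≤ suc o
  h≤1+o = ⊔-lub (≮⇒≥ o≮a) (s≤s q≤o)
  1+o≤N : suc o ≤ N
  1+o≤N = subst (o <_) o+m (m<m+n o z<s)

module _ {n} (x : Vec ℕ n) {i : Fin n} (first : FirstDeltaPosFrom 0 x i) where
  private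
    pos   = proj₁ first
    below = proj₂ first

  decr-InRange : InRange x → Nondecreasing x → InRange (decr x i)
  decr-InRange range nd = mapFrom-pointwise (_∸ 1) x i (λ a → 1 ≤ a × a ≤ suc n) (λ j _ → range j)
    (λ j i≤j → ∸-monoˡ-≤ 1 (≤-trans (≤-trans (s≤s (s≤s z≤n)) pos) (nd i j i≤j)) , ≤-trans (m∸n≤m _ 1) (proj₂ (range j)))

  decr-Nondecreasing : Nondecreasing x → Nondecreasing (decr x i)
  decr-Nondecreasing = mapFrom-nondecreasing (_∸ 1) x i (∸-monoˡ-≤ 1)
    (λ j j<i → ≤-trans (≮⇒≥ (below j j<i)) (≤-trans (m≤n⇒m≤1+n j<i) (∸-monoˡ-≤ 1 pos)))

  decr-InD : InD (decr x i) i
  decr-InD = subst (suc (toℕ i) ≤_) (sym (lookup-mapFrom-≥ (_∸ 1) x i ≤-refl)) (∸-monoˡ-≤ 1 pos)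
           , λ j j<i → below j j<i ∘ subst (suc (toℕ j) <_) (lookup-mapFrom-< (_∸ 1) x i j<i)

defect-decr : ∀ {n} (x : Vec ℕ n) {i} → InRange x → Nondecreasing x → firstPos x ≡ just i →
  defect n x ≡ suc (defect n (decr x i))
defect-decr {n} x {i} range nd fp = begin
  defect n x                                      ≡⟨ defect-sorted x range nd ⟩
  overflow n (spots 0 (toList x))                 ≡⟨ overflow-decr 0 0 x fp z≤n refl (InRange⇒All≤ x range) ⟩
  suc (overflow n (spots 0 (toList (decr x i))))  ≡⟨ cong suc (defect-sorted (decr x i) range′ nd′) ⟨
  suc (defect n (decr x i))                       ∎
  where
  open ≡-Reasoning
  first  = firstPosFrom⇒FirstDeltaPosFrom 0 x fp
  range′ = decr-InRange x first range nd
  nd′    = decr-Nondecreasing x first nd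

firstPos-defined : ∀ {n d} (x : Vec ℕ n) → DPFup n d x → 1 ≤ d → ∃ λ i → firstPos x ≡ just i
firstPos-defined x (range , nd , refl) 1≤d with firstPos x in fp
... | just i  = i , refl
... | nothing = contradiction (≤-reflexive (trans (defect-sorted x range nd) (firstPosFrom-nothing⇒overflow≡0 0 0 x fp z≤n refl)))
                              (<⇒≱ 1≤d)

decr-DPFup : ∀ {n d} (x : Vec ℕ n) {i} → firstPos x ≡ just i → DPFup n d x → DPFup n (d ∸ 1) (decr x i)
decr-DPFup x fp (range , nd , refl) =
  decr-InRange x first range nd , decr-Nondecreasing x first nd , cong (_∸ 1) (sym (defect-decr x range nd fp))
  where first = firstPosFrom⇒FirstDeltaPosFrom 0 x fp

decr-LastLe : ∀ {n} (x : Vec ℕ n) i k → LastLe x k → LastLe (decr x i) (k ∸ 1)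
decr-LastLe {zero}  x i k _  = _
decr-LastLe {suc m} x i k le = subst (_≤ k ∸ 1) (sym (last-mapFrom (_∸ 1) x i)) (∸-monoˡ-≤ 1 le)

φ-just : ∀ {n} (x : Vec ℕ n) {i} → firstPos x ≡ just i → φ x ≡ just (decr x i , i)
φ-just x = cong (mapMaybe (λ i → decr x i , i))

decr-injective : ∀ {n} (x y : Vec ℕ n) {i} → InRange x → InRange y → decr x i ≡ decr y i → x ≡ y
decr-injective x y {i} range-x range-y decr≡ = begin
  x                 ≡⟨ incr∘decr x range-x ⟨
  incr (decr x i) i ≡⟨ cong (λ v → incr v i) decr≡ ⟩
  incr (decr y i) i ≡⟨ incr∘decr y range-y ⟩
  y                 ∎
  where
  open ≡-Reasoning
  incr∘decr : ∀ v → InRange v → incr (decr v i) i ≡ v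
  incr∘decr v range = mapFrom-inverse (_∸ 1) suc v i (λ j _ → m+[n∸m]≡n (proj₁ (range j)))

φ-injective : ∀ {n d} (x y : Vec ℕ n) → 1 ≤ d → DPFup n d x → DPFup n d y → φ x ≡ φ y → x ≡ y
φ-injective x y 1≤d dx dy φ≡ with firstPos-defined x dx 1≤d | firstPos-defined y dy 1≤d
... | i , fx | j , fy with ,-injective (just-injective (trans (sym (φ-just x fx)) (trans φ≡ (φ-just y fy))))
... | decr≡ , refl = decr-injective x y {i} (proj₁ dx) (proj₁ dy) decr≡

module _ {n} (x : Vec ℕ n) {i : Fin n} (inD : InD x i) where

  incr-firstPos : firstPos (incr x i) ≡ just i
  incr-firstPos = FirstDeltaPosFrom⇒firstPosFrom 0 (incr x i) i
    ( subst (suc (toℕ i) <_) (sym (lookup-mapFrom-≥ suc x i ≤-refl)) (s≤s (proj₁ inD))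
    , λ j j<i → proj₂ inD j j<i ∘ subst (suc (toℕ j) <_) (lookup-mapFrom-< suc x i j<i))

  incr-InRange : InRange x → (∀ j → lookup x j ≤ n) → InRange (incr x i)
  incr-InRange range bound =
    mapFrom-pointwise suc x i (λ a → 1 ≤ a × a ≤ suc n) (λ j _ → range j) (λ j _ → s≤s z≤n , s≤s (bound j))

  incr-Nondecreasing : Nondecreasing x → Nondecreasing (incr x i)
  incr-Nondecreasing nd = mapFrom-nondecreasing suc x i s≤s (λ j j<i → m≤n⇒m≤1+n (nd j i (<⇒≤ j<i))) nd

incr-LastLe : ∀ {n} (x : Vec ℕ n) i k → 1 ≤ k → LastLe x (k ∸ 1) → LastLe (incr x i) k
incr-LastLe {zero}  x i k _   _  = _
incr-LastLe {suc m} x i k 1≤k le = subst₂ _≤_ (sym (last-mapFrom suc x i)) (m+[n∸m]≡n 1≤k) (s≤s le)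

decr∘incr : ∀ {n} (x : Vec ℕ n) i → decr (incr x i) i ≡ x
decr∘incr x i = mapFrom-inverse suc (_∸ 1) x i (λ _ _ → refl)

φ-surjective : ∀ {n k d} → k ≤ suc n → 1 ≤ k → 1 ≤ d → ∀ (x′ : Vec ℕ n) j → InN n (d ∸ 1) x′ j →
  LastLe x′ (k ∸ 1) → ∃ λ x → (DPFup n d x × LastLe x k) × φ x ≡ just (x′ , j)
φ-surjective {n} {k} {d} k≤ 1≤k 1≤d x′ j ((range′ , nd′ , def′) , inD) le =
  incr x′ j , ((range , nd , defect≡) , incr-LastLe x′ j k 1≤k le) , φ≡
  where
  open ≡-Reasoning
  range : InRange (incr x′ j)
  range = incr-InRange x′ inD range′ λ l → ≤-trans (LastLe⇒lookup≤ x′ (k ∸ 1) nd′ le l) (∸-monoˡ-≤ 1 k≤)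
  nd : Nondecreasing (incr x′ j)
  nd = incr-Nondecreasing x′ inD nd′
  defect≡ : defect n (incr x′ j) ≡ d
  defect≡ = begin
    defect n (incr x′ j)                 ≡⟨ defect-decr (incr x′ j) range nd (incr-firstPos x′ inD) ⟩
    suc (defect n (decr (incr x′ j) j))  ≡⟨ cong (suc ∘ defect n) (decr∘incr x′ j) ⟩
    suc (defect n x′)                    ≡⟨ cong suc def′ ⟩
    suc (d ∸ 1)                          ≡⟨ m+[n∸m]≡n 1≤d ⟩
    d                                    ∎
  φ≡ : φ (incr x′ j) ≡ just (x′ , j)
  φ≡ = trans (φ-just (incr x′ j) (incr-firstPos x′ inD)) (cong (λ v → just (v , j)) (decr∘incr x′ j))

InD-cong : ∀ {n} (x y : Vec ℕ n) {j} → (∀ l → l F.≤ j → lookup x l ≡ lookup y l) → InD x j → InD y j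
InD-cong x y {j} x≗y (nonneg , below) =
    subst (suc (toℕ j) ≤_) (x≗y j ≤-refl) nonneg
  , λ l l<j → below l l<j ∘ subst (suc (toℕ l) <_) (sym (x≗y l (<⇒≤ l<j)))

InD-decr : ∀ {n} (x : Vec ℕ n) {i} → firstPos x ≡ just i → ∀ j → InD x j ⇔ (InD (decr x i) j × j F.≤ i)
InD-decr x {i} fp j = mk⇔ to from
  where
  first = firstPosFrom⇒FirstDeltaPosFrom 0 x fp
  agree : j F.< i → ∀ l → l F.≤ j → lookup x l ≡ lookup (decr x i) l
  agree j<i l l≤j = sym (lookup-mapFrom-< (_∸ 1) x i (≤-<-trans l≤j j<i))
  to : InD x j → InD (decr x i) j × j F.≤ i
  to inD with FinP.<-cmp j i
  ... | tri< j<i _ _  = InD-cong x (decr x i) (agree j<i) inD , <⇒≤ j<i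
  ... | tri≈ _ refl _ = decr-InD x first , ≤-refl
  ... | tri> _ _ i<j  = contradiction (proj₁ first) (proj₂ inD i i<j)
  from : InD (decr x i) j × j F.≤ i → InD x j
  from (inD′ , j≤i) with FinP.<-cmp j i
  ... | tri< j<i _ _  = InD-cong (decr x i) x (λ l l≤j → sym (agree j<i l l≤j)) inD′
  ... | tri≈ _ refl _ = <⇒≤ (proj₁ first) , proj₂ first
  ... | tri> _ _ i<j  = contradiction j≤i (<⇒≱ i<j)

lemma4p5 : (n k d : ℕ) → 1 ≤ k → k ≤ suc n → 1 ≤ d →
    -- φ is defined on A = {x ∈ DPF↑_{n,n,d} : x_n ≤ k} and maps it into
    -- B = {(x',j) ∈ N_{n,d-1} : x'_n ≤ k-1}
    (∀ (x : Vec ℕ n) → DPFup n d x → LastLe x k →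
       ∃ λ (i : Fin n) → firstPos x ≡ just i ×
         (InN n (d ∸ 1) (decr x i) i × LastLe (decr x i) (k ∸ 1)))
    -- φ is injective on A
    × (∀ (x y : Vec ℕ n) → DPFup n d x → LastLe x k → DPFup n d y → LastLe y k →
         φ x ≡ φ y → x ≡ y)
    -- φ is surjective onto B
    × (∀ (x' : Vec ℕ n) (j : Fin n) → InN n (d ∸ 1) x' j → LastLe x' (k ∸ 1) →
         ∃ λ (x : Vec ℕ n) → (DPFup n d x × LastLe x k) × φ x ≡ just (x' , j))
    -- D(x) = {j ∈ D(x') | j ≤ i}
    × (∀ (x : Vec ℕ n) (i : Fin n) → DPFup n d x → LastLe x k → firstPos x ≡ just i →
         ∀ (j : Fin n) → InD x j ⇔ (InD (decr x i) j × j F.≤ i))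
lemma4p5 n k d 1≤k k≤ 1≤d =
    maps-into
  , (λ x y dx _ dy _ → φ-injective x y 1≤d dx dy)
  , φ-surjective k≤ 1≤k 1≤d
  , (λ x _ _ _ → InD-decr x)
  where
  maps-into : ∀ (x : Vec ℕ n) → DPFup n d x → LastLe x k → ∃ λ (i : Fin n) → firstPos x ≡ just i ×
                (InN n (d ∸ 1) (decr x i) i × LastLe (decr x i) (k ∸ 1))
  maps-into x dx le with firstPos-defined x dx 1≤d
  ... | i , fp = i , fp , (decr-DPFup x fp dx , decr-InD x (firstPosFrom⇒FirstDeltaPosFrom 0 x fp)) , decr-LastLe x i k le
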